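{- Let $\{Q_n\}_{n\ge 0}$ be the Pell–Lucas sequence, defined by $Q_0=2$, $Q_1=2$ and $Q_{n+2}=2Q_{n+1}+Q_n$ for all $n\ge 0$. If $n$ and $m$ are nonnegative integers such that $$Q_n=a\left(\frac{10^m-1}{9}\right)\quad\text{for some } a\in\{1,2,\ldots,9\},$$ then $n\in\{0,1,2\}$. -}

module Defs where

open import Data.Nat using (ℕ; zero; suc; _+_; _*_)

Q : ℕ → ℕ
Q zero = 2
Q (suc zero) = 2
Q (suc (suc n)) = 2 * Q (suc n) + Q n

-- Write R m = (10^m − 1)/9 for the repunit 11…1 (m ones); a repdigit is a·R m
-- with a < 10.  For n ≥ 3 we rule out Q n = a·R m by splitting on m.
--
--  * Long repdigits (m ≥ 4).  Since 80 ∣ 10^4, R m ≡ 1111 ≡ 71 (mod 80), so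
--    a·R m ≡ 71a (mod 80).  Consecutive residues of Q mod 80 run through a
--    twelve-term cycle (an invariant-set argument for the recurrence reduced
--    mod d), and no residue 71a with a < 10 occurs in it.  This excludes every
--    n at once.
--  * Short repdigits (m ≤ 3).  Then a·R m ≤ 999 < 1154 = Q 8, and Q grows
--    monotonically, so only Q 3, …, Q 7 remain; a finite check disposes of
--    them.
module Submission where

open import Defs
open import Data.Nat
  using (ℕ; zero; suc; _+_; _*_; _∸_; _^_; _/_; _%_; _≤_; _<_; _≤′_; ≤′-refl; ≤′-step; s≤s; NonZero)
open import Data.Nat.Properties
open import Data.Nat.DivMod using (m*n/n≡m; %-distribˡ-+; %-distribˡ-*; m%n%n≡m%n)
open import Data.Nat.Tactic.RingSolver using (solve-∀)
open import Data.Product using (_×_; _,_; proj₁)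
open import Data.Product.Properties using (≡-dec)
open import Data.List using (List; _∷_; []; map; upTo)
open import Data.List.Relation.Unary.All as All using (All; all?)
open import Data.List.Relation.Unary.Any using (here)
open import Data.List.Membership.Propositional using (_∈_; _∉_)
open import Data.List.Membership.Propositional.Properties using (∈-upTo⁺; ∈-map⁺)
import Data.List.Membership.DecPropositional as DecMembership
open import Data.Sum using (_⊎_; inj₁; inj₂)
open import Data.Empty using (⊥-elim)
open import Relation.Nullary using (¬?; yes; no)
open import Relation.Nullary.Decidable using (from-yes)
open import Relation.Binary.PropositionalEquality

module ℕ-Membership = DecMembership _≟_
module ℕ²-Membership = DecMembership (≡-dec _≟_ _≟_)

repunit : ℕ → ℕ
repunit zero    = 0
repunit (suc m) = 10 * repunit m + 1

repunit-closed : ∀ m → 9 * repunit m + 1 ≡ 10 ^ m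
repunit-closed zero    = refl
repunit-closed (suc m) = begin
  9 * (10 * repunit m + 1) + 1  ≡⟨ shift-digit (repunit m) ⟩
  10 * (9 * repunit m + 1)      ≡⟨ cong (10 *_) (repunit-closed m) ⟩
  10 * 10 ^ m                   ∎
  where
  open ≡-Reasoning
  shift-digit : ∀ r → 9 * (10 * r + 1) + 1 ≡ 10 * (9 * r + 1)
  shift-digit = solve-∀

repunit-formula : ∀ m → (10 ^ m ∸ 1) / 9 ≡ repunit m
repunit-formula m = begin
  (10 ^ m ∸ 1) / 9           ≡⟨ cong (λ t → (t ∸ 1) / 9) (sym (repunit-closed m)) ⟩
  (9 * repunit m + 1 ∸ 1) / 9 ≡⟨ cong (_/ 9) (m+n∸n≡m (9 * repunit m) 1) ⟩
  (9 * repunit m) / 9        ≡⟨ cong (_/ 9) (*-comm 9 (repunit m)) ⟩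
  (repunit m * 9) / 9        ≡⟨ m*n/n≡m (repunit m) 9 ⟩
  repunit m                  ∎
  where open ≡-Reasoning

monotone-by-steps : (f : ℕ → ℕ) → (∀ n → f n ≤ f (suc n)) → ∀ {m n} → m ≤ n → f m ≤ f n
monotone-by-steps f step m≤n = go (≤⇒≤′ m≤n)
  where
  go : ∀ {m n} → m ≤′ n → f m ≤ f n
  go ≤′-refl        = ≤-refl
  go (≤′-step m≤′n) = ≤-trans (go m≤′n) (step _)

Q-monotone : ∀ {m n} → m ≤ n → Q m ≤ Q n
Q-monotone = monotone-by-steps Q step
  where
  step : ∀ n → Q n ≤ Q (suc n)
  step zero    = ≤-refl
  step (suc n) = ≤-trans (m≤n*m (Q (suc n)) 2) (m≤m+n (2 * Q (suc n)) (Q n))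

repunit-monotone : ∀ {m n} → m ≤ n → repunit m ≤ repunit n
repunit-monotone = monotone-by-steps repunit step
  where
  step : ∀ n → repunit n ≤ repunit (suc n)
  step n = ≤-trans (m≤n*m (repunit n) 10) (m≤m+n (10 * repunit n) 1)

%-scale : ∀ u y d .{{_ : NonZero d}} → (u * y) % d ≡ (u * (y % d)) % d
%-scale u y d = begin
  (u * y) % d                     ≡⟨ %-distribˡ-* u y d ⟩
  ((u % d) * (y % d)) % d         ≡⟨ cong (λ t → ((u % d) * t) % d) (sym (m%n%n≡m%n y d)) ⟩
  ((u % d) * ((y % d) % d)) % d   ≡⟨ sym (%-distribˡ-* u (y % d) d) ⟩
  (u * (y % d)) % d               ∎
  where open ≡-Reasoning

-- So does a linear step u·y + x; both recurrences (for Q and for R) have this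
-- shape, which is what lets them be run on residues.
%-linear : ∀ u y x d .{{_ : NonZero d}} → (u * y + x) % d ≡ (u * (y % d) + x % d) % d
%-linear u y x d = begin
  (u * y + x) % d                          ≡⟨ %-distribˡ-+ (u * y) x d ⟩
  ((u * y) % d + x % d) % d                ≡⟨ cong₂ (λ s t → (s + t) % d) (%-scale u y d) (sym (m%n%n≡m%n x d)) ⟩
  ((u * (y % d)) % d + (x % d) % d) % d    ≡⟨ sym (%-distribˡ-+ (u * (y % d)) (x % d) d) ⟩
  (u * (y % d) + x % d) % d                ∎
  where open ≡-Reasoning

pellLucasStep : (d : ℕ) .{{_ : NonZero d}} → ℕ × ℕ → ℕ × ℕ
pellLucasStep d (x , y) = y , (2 * y + x) % d

residuePair : (d : ℕ) .{{_ : NonZero d}} → ℕ → ℕ × ℕ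
residuePair d n = Q n % d , Q (suc n) % d

residuePair-suc : ∀ d .{{_ : NonZero d}} n → residuePair d (suc n) ≡ pellLucasStep d (residuePair d n)
residuePair-suc d n = cong (Q (suc n) % d ,_) (%-linear 2 (Q (suc n)) (Q n) d)

residue-invariant : ∀ d .{{_ : NonZero d}} (P : ℕ × ℕ → Set) →
  P (residuePair d 0) → (∀ {p} → P p → P (pellLucasStep d p)) →
  ∀ n → P (residuePair d n)
residue-invariant d P start closed zero    = start
residue-invariant d P start closed (suc n) =
  subst P (sym (residuePair-suc d n)) (closed (residue-invariant d P start closed n))

cycle80 : List (ℕ × ℕ)
cycle80 = (2 , 2) ∷ (2 , 6) ∷ (6 , 14) ∷ (14 , 34) ∷ (34 , 2) ∷ (2 , 38)
        ∷ (38 , 78) ∷ (78 , 34) ∷ (34 , 66) ∷ (66 , 6) ∷ (6 , 78) ∷ (78 , 2) ∷ []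

cycle80-closed : All (λ p → pellLucasStep 80 p ∈ cycle80) cycle80
cycle80-closed = from-yes (all? (λ p → pellLucasStep 80 p ℕ²-Membership.∈? cycle80) cycle80)

Q-mod-80 : ∀ n → Q n % 80 ∈ map proj₁ cycle80
Q-mod-80 n = ∈-map⁺ proj₁ (residue-invariant 80 (_∈ cycle80) (here refl) (All.lookup cycle80-closed) n)

-- Because 10^4 ≡ 0 (mod 80), every repunit with at least four digits is ≡ 1111 ≡ 71.
repunit-mod-80 : ∀ {m} → 4 ≤′ m → repunit m % 80 ≡ 71
repunit-mod-80 ≤′-refl          = refl
repunit-mod-80 (≤′-step {m} 4≤′m) = begin
  (10 * repunit m + 1) % 80         ≡⟨ %-linear 10 (repunit m) 1 80 ⟩
  (10 * (repunit m % 80) + 1) % 80  ≡⟨ cong (λ r → (10 * r + 1) % 80) (repunit-mod-80 4≤′m) ⟩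
  71                                ∎
  where open ≡-Reasoning

digit-multiples-of-71 : All (λ a → (a * 71) % 80 ∉ map proj₁ cycle80) (upTo 10)
digit-multiples-of-71 =
  from-yes (all? (λ a → (a * 71) % 80 ℕ-Membership.∉? map proj₁ cycle80) (upTo 10))

no-long-repdigit : ∀ n m a → a < 10 → 4 ≤ m → Q n ≢ a * repunit m
no-long-repdigit n m a a<10 4≤m eq =
  All.lookup digit-multiples-of-71 (∈-upTo⁺ a<10) (subst (_∈ map proj₁ cycle80) residue (Q-mod-80 n))
  where
  open ≡-Reasoning
  residue : Q n % 80 ≡ (a * 71) % 80
  residue = begin
    Q n % 80                   ≡⟨ cong (_% 80) eq ⟩
    (a * repunit m) % 80       ≡⟨ %-scale a (repunit m) 80 ⟩
    (a * (repunit m % 80)) % 80 ≡⟨ cong (λ r → (a * r) % 80) (repunit-mod-80 (≤⇒≤′ 4≤m)) ⟩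
    (a * 71) % 80              ∎

short-repdigit-< : ∀ {m a} → a < 10 → m < 4 → a * repunit m < Q 8
short-repdigit-< {m} {a} (s≤s a≤9) (s≤s m≤3) = begin-strict
  a * repunit m  ≤⟨ *-mono-≤ a≤9 (repunit-monotone m≤3) ⟩
  9 * repunit 3  <⟨ from-yes (999 <? 1154) ⟩
  Q 8            ∎
  where open ≤-Reasoning

middle-terms : All (λ k → All (λ m → All (λ a → Q (3 + k) ≢ a * repunit m) (upTo 10)) (upTo 4)) (upTo 5)
middle-terms = from-yes (all? (λ k → all? (λ m → all? (λ a → ¬? (Q (3 + k) ≟ a * repunit m)) (upTo 10)) (upTo 4)) (upTo 5))

no-short-repdigit : ∀ k m a → a < 10 → m < 4 → Q (3 + k) ≢ a * repunit m
no-short-repdigit k m a a<10 m<4 with k <? 5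
... | yes k<5 = All.lookup (All.lookup (All.lookup middle-terms (∈-upTo⁺ k<5)) (∈-upTo⁺ m<4)) (∈-upTo⁺ a<10)
... | no  k≮5 = λ eq → <⇒≱ (short-repdigit-< a<10 m<4) (subst (Q 8 ≤_) eq (Q-monotone (+-monoʳ-≤ 3 (≮⇒≥ k≮5))))

no-repdigit-beyond-2 : ∀ k m a → a < 10 → Q (3 + k) ≢ a * repunit m
no-repdigit-beyond-2 k m a a<10 with m <? 4
... | yes m<4 = no-short-repdigit k m a a<10 m<4
... | no  m≮4 = no-long-repdigit (3 + k) m a a<10 (≮⇒≥ m≮4)

theorem21 : (n m a : ℕ) → 1 ≤ a → a ≤ 9 →
    Q n ≡ a * ((10 ^ m ∸ 1) / 9) →
    n ≡ 0 ⊎ n ≡ 1 ⊎ n ≡ 2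
theorem21 0 _ _ _ _ _ = inj₁ refl
theorem21 1 _ _ _ _ _ = inj₂ (inj₁ refl)
theorem21 2 _ _ _ _ _ = inj₂ (inj₂ refl)
theorem21 (suc (suc (suc k))) m a _ a≤9 eq =
  ⊥-elim (no-repdigit-beyond-2 k m a (s≤s a≤9) (trans eq (cong (a *_) (repunit-formula m))))
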